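{- The down-degree enumerator polynomials of the Fibonacci-run graphs have generating function $$\sum_{n \geq 1} t^n \sum_{v \in V(\mathcal{R}_n)} d^{\deg_{down}(v)} = \frac{t\left(1 + d + dt + (d^2-1)t^2 + d(d-1)t^3 + d(d-1)t^4\right)}{1 - t - t^2 - (d-1)t^3 - d(d-1)t^5}.$$
   Context: A binary string is called run-constrained if every run (maximal block) of consecutive $1$s in it is immediately followed by a run of $0$s of strictly greater length. For $n \geq 1$, the Fibonacci-run graph $\mathcal{R}_n$ has vertex set $\{ w \in \{0,1\}^n : w00 \text{ is a run-constrained string of length } n+2\}$, and two vertices are adjacent iff they differ in exactly one coordinate. For $v \in V(\mathcal{R}_n)$, $\deg_{down}(v)$ is the number of neighbors of $v$ in $\mathcal{R}_n$ obtained from $v$ by changing a $1$ into a $0$. -}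

module Defs where

open import Data.Bool using (Bool; true; false; _∧_; if_then_else_)
open import Data.Bool.Properties using () renaming (_≟_ to _≟ᵇ_)
open import Data.Nat using (ℕ; zero; suc; _<ᵇ_; _∸_)
open import Data.Integer using (ℤ; _+_; _*_; _-_; _^_; +_; 0ℤ; 1ℤ)
open import Data.List using (List; []; _∷_; _++_; map; filterᵇ; length; upTo; concatMap)
open import Data.Product using (_×_; _,_)
open import Relation.Nullary.Decidable using (⌊_⌋)

runs : List Bool → List (Bool × ℕ)
runs [] = []
runs (b ∷ w) with runs w
... | [] = (b , 1) ∷ []
... | (c , k) ∷ r = if ⌊ b ≟ᵇ c ⌋ then (c , suc k) ∷ r else (b , 1) ∷ (c , k) ∷ r

okRuns : List (Bool × ℕ) → Bool
okRuns [] = true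
okRuns ((false , _) ∷ r) = okRuns r
okRuns ((true , a) ∷ []) = false
okRuns ((true , a) ∷ (false , b) ∷ r) = (a <ᵇ b) ∧ okRuns r
okRuns ((true , a) ∷ (true , b) ∷ r) = false

runConstrained : List Bool → Bool
runConstrained w = okRuns (runs w)

words : ℕ → List (List Bool)
words zero = [] ∷ []
words (suc n) = concatMap (λ w → (false ∷ w) ∷ (true ∷ w) ∷ []) (words n)

isVertex : List Bool → Bool
isVertex w = runConstrained (w ++ false ∷ false ∷ [])

vertices : ℕ → List (List Bool)
vertices n = filterᵇ isVertex (words n)

-- value at position i (positions beyond the end read as false)
at : ℕ → List Bool → Bool
at i [] = false
at zero (b ∷ w) = b
at (suc i) (b ∷ w) = at i w

clear : ℕ → List Bool → List Bool
clear i [] = []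
clear zero (b ∷ w) = false ∷ w
clear (suc i) (b ∷ w) = b ∷ clear i w

degDown : List Bool → ℕ
degDown v = length (filterᵇ (λ i → at i v ∧ isVertex (clear i v)) (upTo (length v)))

sumℤ : List ℤ → ℤ
sumℤ [] = 0ℤ
sumℤ (x ∷ xs) = x + sumℤ xs

downEnum : ℤ → ℕ → ℤ
downEnum d n = sumℤ (map (λ v → d ^ degDown v) (vertices n))

Series : Set
Series = ℕ → ℤ

_⊛_ : Series → Series → Series
(f ⊛ g) k = sumℤ (map (λ i → f i * g (k ∸ i)) (upTo (suc k)))

genFun : ℤ → Series
genFun d zero = 0ℤ
genFun d (suc n) = downEnum d (suc n)

numer : ℤ → Series
numer d 1 = 1ℤ + d
numer d 2 = d
numer d 3 = d * d - 1ℤ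
numer d 4 = d * (d - 1ℤ)
numer d 5 = d * (d - 1ℤ)
numer d _ = 0ℤ

denom : ℤ → Series
denom d 0 = 1ℤ
denom d 1 = Data.Integer.-_ 1ℤ
denom d 2 = Data.Integer.-_ 1ℤ
denom d 3 = Data.Integer.-_ (d - 1ℤ)
denom d 5 = Data.Integer.-_ (d * (d - 1ℤ))
denom d _ = 0ℤ

{-# OPTIONS --safe #-}
-- A vertex of R_n is a word w with w00 run-constrained. Read from the left, such a word is a
-- leading 0 followed by a vertex, or a block 1^(a+1) 0^(a+2) followed by a vertex, or a last
-- block whose final zeros are supplied by the padding 00. Down-degrees add up along this
-- decomposition, a block contributing 1 when a = 0 and 2 otherwise. Tracking the states
-- "after a+1 ones" and "after a+1 ones and b+1 zeros" yields linear recurrences which combine to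
--   R(n+3) = R(n+2) + R(n+1) + (d-1) R(n) + d(d-1) R(n-2),   R(-1) = R(-2) = 1,
-- for the down-degree enumerators R(n). Multiplying by the denominator, this recurrence kills
-- every coefficient from t^6 on; the first ones follow from R(0) = 1, R(1) = 1 + d,
-- R(2) = 1 + 2d and the recurrence at n = 0, 1, 2.
module Submission where

open import Defs
open import Function using (_∘_; id)
open import Data.Bool using (Bool; true; false; not; _∧_; if_then_else_)
open import Data.List
  using (List; []; _∷_; _++_; _∷ʳ_; map; replicate; length; filterᵇ; concatMap; applyUpTo)
open import Data.List.Properties using (++-assoc; ++-identityʳ; map-upTo; applyUpTo-∷ʳ)
open import Data.Nat using (ℕ; zero; suc; _∸_; _≤_; _<_; z≤n; s≤s)
import Data.Nat as ℕ
import Data.Nat.Properties as ℕ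
open import Data.Product using (Σ-syntax; _×_; _,_)
open import Relation.Binary.PropositionalEquality
open ≡-Reasoning

-- Runs and clearable ones

module _ where
  open import Data.Nat using (_+_; _<ᵇ_; z<s)
  open import Data.Nat.Properties using (<ᵇ-reflects-<; ≤⇒≯; ≤-trans; m≤m+n; n<1+n; m<n+m)
  open import Relation.Nullary.Reflects using (det; ofʸ; ofⁿ)

  ones zeros : ℕ → List Bool
  ones k = replicate k true
  zeros k = replicate k false

  replicate-∷ʳ : ∀ {A : Set} m (x : A) → replicate m x ++ x ∷ [] ≡ replicate (suc m) x
  replicate-∷ʳ zero    x = refl
  replicate-∷ʳ (suc m) x = cong (x ∷_) (replicate-∷ʳ m x)

  replicate-++-∷ : ∀ {A : Set} m (x : A) v → replicate m x ++ x ∷ v ≡ replicate (suc m) x ++ v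
  replicate-++-∷ zero    x v = refl
  replicate-++-∷ (suc m) x v = cong (x ∷_) (replicate-++-∷ m x v)

  replicate-+-++ : ∀ {A : Set} m n (x : A) v → replicate (m + n) x ++ v ≡ replicate m x ++ replicate n x ++ v
  replicate-+-++ zero    n x v = refl
  replicate-+-++ (suc m) n x v = cong (x ∷_) (replicate-+-++ m n x v)

  <ᵇ-true : ∀ {m n} → m < n → (m <ᵇ n) ≡ true
  <ᵇ-true {m} {n} m<n = det (<ᵇ-reflects-< m n) (ofʸ m<n)

  <ᵇ-false : ∀ {m n} → n ≤ m → (m <ᵇ n) ≡ false
  <ᵇ-false {m} {n} n≤m = det (<ᵇ-reflects-< m n) (ofⁿ (≤⇒≯ n≤m))

  runs-∷-same : ∀ b w {k r} → runs w ≡ (b , k) ∷ r → runs (b ∷ w) ≡ (b , suc k) ∷ r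
  runs-∷-same true  w eq rewrite eq = refl
  runs-∷-same false w eq rewrite eq = refl

  runs-∷-other : ∀ b w {k r} → runs w ≡ (not b , k) ∷ r → runs (b ∷ w) ≡ (b , 1) ∷ (not b , k) ∷ r
  runs-∷-other true  w eq rewrite eq = refl
  runs-∷-other false w eq rewrite eq = refl

  runs-∷-head : ∀ b w → Σ[ k ∈ ℕ ] Σ[ r ∈ List (Bool × ℕ) ] runs (b ∷ w) ≡ (b , k) ∷ r
  runs-∷-head true w with runs w
  ... | []              = 1 , [] , refl
  ... | (true , k) ∷ r  = suc k , r , refl
  ... | (false , k) ∷ r = 1 , _ , refl
  runs-∷-head false w with runs w
  ... | []              = 1 , [] , refl
  ... | (true , k) ∷ r  = 1 , _ , refl
  ... | (false , k) ∷ r = suc k , r , refl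

  data HeadIsNot (b : Bool) : List Bool → Set where
    nil  : HeadIsNot b []
    cons : ∀ y → HeadIsNot b (not b ∷ y)

  runs-replicate-++ : ∀ b k {y} → HeadIsNot b y → runs (replicate (suc k) b ++ y) ≡ (b , suc k) ∷ runs y
  runs-replicate-++ b zero    nil      = refl
  runs-replicate-++ b zero    (cons y) with runs-∷-head (not b) y
  ... | _ , _ , eq = trans (runs-∷-other b (not b ∷ y) eq) (cong ((b , 1) ∷_) (sym eq))
  runs-replicate-++ b (suc k) {y} h    = runs-∷-same b (replicate (suc k) b ++ y) (runs-replicate-++ b k h)

  runs-ones-zeros : ∀ a b {y} → HeadIsNot false y →
    runs (ones (suc a) ++ zeros (suc b) ++ y) ≡ (true , suc a) ∷ (false , suc b) ∷ runs y
  runs-ones-zeros a b h =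
    trans (runs-replicate-++ true a (cons _)) (cong ((true , suc a) ∷_) (runs-replicate-++ false b h))

  runConstrained-0∷ : ∀ x → runConstrained (false ∷ x) ≡ runConstrained x
  runConstrained-0∷ x with runs x
  ... | []              = refl
  ... | (false , k) ∷ r = refl
  ... | (true , k) ∷ r  = refl

  runConstrained-zeros-++ : ∀ k x → runConstrained (zeros k ++ x) ≡ runConstrained x
  runConstrained-zeros-++ zero    x = refl
  runConstrained-zeros-++ (suc k) x = trans (runConstrained-0∷ (zeros k ++ x)) (runConstrained-zeros-++ k x)

  split-leadingZeros : ∀ x → Σ[ m ∈ ℕ ] Σ[ y ∈ List Bool ] x ≡ zeros m ++ y × HeadIsNot false y
  split-leadingZeros []          = 0 , [] , refl , nil
  split-leadingZeros (true ∷ x)  = 0 , true ∷ x , refl , cons x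
  split-leadingZeros (false ∷ x) with split-leadingZeros x
  ... | m , y , refl , h = suc m , y , refl , h

  runConstrained-ones-zeros : ∀ {a b} x → a < b →
    runConstrained (ones (suc a) ++ zeros (suc b) ++ x) ≡ runConstrained x
  runConstrained-ones-zeros {a} {b} x a<b with split-leadingZeros x
  ... | m , y , refl , h = begin
    runConstrained (ones (suc a) ++ zeros (suc b) ++ zeros m ++ y)
      ≡⟨ cong (λ v → runConstrained (ones (suc a) ++ v)) (sym (replicate-+-++ (suc b) m false y)) ⟩
    runConstrained (ones (suc a) ++ zeros (suc (b + m)) ++ y)
      ≡⟨ cong okRuns (runs-ones-zeros a (b + m) h) ⟩
    (suc a <ᵇ suc (b + m)) ∧ runConstrained y
      ≡⟨ cong (_∧ runConstrained y) (<ᵇ-true (s≤s (≤-trans a<b (m≤m+n b m)))) ⟩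
    runConstrained y
      ≡⟨ sym (runConstrained-zeros-++ m y) ⟩
    runConstrained (zeros m ++ y) ∎

  runConstrained-ones-zeros-false : ∀ {a b y} → b ≤ a → HeadIsNot false y →
    runConstrained (ones (suc a) ++ zeros (suc b) ++ y) ≡ false
  runConstrained-ones-zeros-false {a} {b} {y} b≤a h = begin
    runConstrained (ones (suc a) ++ zeros (suc b) ++ y)
      ≡⟨ cong okRuns (runs-ones-zeros a b h) ⟩
    (suc a <ᵇ suc b) ∧ runConstrained y
      ≡⟨ cong (_∧ runConstrained y) (<ᵇ-false (s≤s b≤a)) ⟩
    false ∎

  runConstrained-ones-zeros-++ : ∀ {a b} w s → a < b →
    runConstrained (ones (suc a) ++ (zeros (suc b) ++ w) ++ s) ≡ runConstrained (w ++ s)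
  runConstrained-ones-zeros-++ {a} {b} w s a<b = begin
    runConstrained (ones (suc a) ++ (zeros (suc b) ++ w) ++ s)
      ≡⟨ cong (λ v → runConstrained (ones (suc a) ++ v)) (++-assoc (zeros (suc b)) w s) ⟩
    runConstrained (ones (suc a) ++ zeros (suc b) ++ w ++ s)
      ≡⟨ runConstrained-ones-zeros (w ++ s) a<b ⟩
    runConstrained (w ++ s) ∎

  runConstrained-block-++ : ∀ a w s →
    runConstrained ((ones (suc a) ++ zeros (2 + a) ++ w) ++ s) ≡ runConstrained (w ++ s)
  runConstrained-block-++ a w s =
    trans (cong runConstrained (++-assoc (ones (suc a)) (zeros (2 + a) ++ w) s))
          (runConstrained-ones-zeros-++ w s (n<1+n a))

  runConstrained-ones-zeros-true∷-++ : ∀ {a b} w s → b ≤ a →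
    runConstrained ((ones (suc a) ++ zeros (suc b) ++ true ∷ w) ++ s) ≡ false
  runConstrained-ones-zeros-true∷-++ {a} {b} w s b≤a = begin
    runConstrained ((ones (suc a) ++ zeros (suc b) ++ true ∷ w) ++ s)
      ≡⟨ cong runConstrained (++-assoc (ones (suc a)) (zeros (suc b) ++ true ∷ w) s) ⟩
    runConstrained (ones (suc a) ++ (zeros (suc b) ++ true ∷ w) ++ s)
      ≡⟨ cong (λ v → runConstrained (ones (suc a) ++ v)) (++-assoc (zeros (suc b)) (true ∷ w) s) ⟩
    runConstrained (ones (suc a) ++ zeros (suc b) ++ true ∷ w ++ s)
      ≡⟨ runConstrained-ones-zeros-false b≤a (cons (w ++ s)) ⟩
    false ∎

  indicator : Bool → ℕ
  indicator true  = 1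
  indicator false = 0

  count : (ℕ → Bool) → ℕ → ℕ
  count p zero    = 0
  count p (suc n) = indicator (p 0) + count (p ∘ suc) n

  length-filterᵇ-applyUpTo : ∀ (p : ℕ → Bool) f n → length (filterᵇ p (applyUpTo f n)) ≡ count (p ∘ f) n
  length-filterᵇ-applyUpTo p f zero = refl
  length-filterᵇ-applyUpTo p f (suc n) with p (f 0)
  ... | true  = cong suc (length-filterᵇ-applyUpTo p (f ∘ suc) n)
  ... | false = length-filterᵇ-applyUpTo p (f ∘ suc) n

  count-cong : ∀ {p q} n → (∀ i → p i ≡ q i) → count p n ≡ count q n
  count-cong zero    p≗q = refl
  count-cong (suc n) p≗q = cong₂ _+_ (cong indicator (p≗q 0)) (count-cong n (p≗q ∘ suc))

  downCount : List Bool → List Bool → List Bool → ℕ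
  downCount p w s = count (λ i → at i w ∧ runConstrained (p ++ clear i w ++ s)) (length w)

  pad : List Bool
  pad = false ∷ false ∷ []

  degDown≡downCount : ∀ w → degDown w ≡ downCount [] w pad
  degDown≡downCount w = length-filterᵇ-applyUpTo _ id (length w)

  downCount-∷ : ∀ p b w s →
    downCount p (b ∷ w) s ≡ indicator (b ∧ runConstrained (p ++ false ∷ w ++ s)) + downCount (p ++ b ∷ []) w s
  downCount-∷ p b w s = cong (indicator (b ∧ runConstrained (p ++ false ∷ w ++ s)) +_)
    (count-cong (length w) λ i → cong (λ v → at i w ∧ runConstrained v) (sym (++-assoc p (b ∷ []) (clear i w ++ s))))

  downCount-prefix : ∀ p q w s → (∀ z → runConstrained (p ++ z) ≡ runConstrained (q ++ z)) →
    downCount p w s ≡ downCount q w s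
  downCount-prefix p q w s p∼q = count-cong (length w) λ i → cong (at i w ∧_) (p∼q (clear i w ++ s))

  downCount-zeros-++ : ∀ p k w s → downCount p (zeros k ++ w) s ≡ downCount (p ++ zeros k) w s
  downCount-zeros-++ p zero    w s = cong (λ q → downCount q w s) (sym (++-identityʳ p))
  downCount-zeros-++ p (suc k) w s = begin
    downCount p (false ∷ zeros k ++ w) s
      ≡⟨ downCount-∷ p false (zeros k ++ w) s ⟩
    downCount (p ++ false ∷ []) (zeros k ++ w) s
      ≡⟨ downCount-zeros-++ (p ++ false ∷ []) k w s ⟩
    downCount ((p ++ false ∷ []) ++ zeros k) w s
      ≡⟨ cong (λ q → downCount q w s) (++-assoc p (false ∷ []) (zeros k)) ⟩
    downCount (p ++ zeros (suc k)) w s ∎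

  downCount-++-zeros : ∀ p w k s → downCount p (w ++ zeros k) s ≡ downCount p w (zeros k ++ s)
  downCount-++-zeros p []      k s = begin
    downCount p (zeros k) s            ≡⟨ cong (λ v → downCount p v s) (sym (++-identityʳ (zeros k))) ⟩
    downCount p (zeros k ++ []) s      ≡⟨ downCount-zeros-++ p k [] s ⟩
    0                                  ∎
  downCount-++-zeros p (b ∷ w) k s = begin
    downCount p (b ∷ w ++ zeros k) s
      ≡⟨ downCount-∷ p b (w ++ zeros k) s ⟩
    indicator (b ∧ runConstrained (p ++ false ∷ (w ++ zeros k) ++ s)) + downCount (p ++ b ∷ []) (w ++ zeros k) s
      ≡⟨ cong₂ (λ v n → indicator (b ∧ runConstrained (p ++ false ∷ v)) + n)
               (++-assoc w (zeros k) s) (downCount-++-zeros (p ++ b ∷ []) w k s) ⟩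
    indicator (b ∧ runConstrained (p ++ false ∷ w ++ zeros k ++ s)) + downCount (p ++ b ∷ []) w (zeros k ++ s)
      ≡⟨ sym (downCount-∷ p b w (zeros k ++ s)) ⟩
    downCount p (b ∷ w) (zeros k ++ s) ∎

  -- Clearing an inner 1 of a run leaves a run followed by a single 0 and then a 1, so only the
  -- last 1 of the run can be cleared.
  downCount-ones : ∀ j m z s → downCount (ones (suc j)) (ones (suc m) ++ z) s
    ≡ indicator (runConstrained (ones (suc j) ++ ones m ++ false ∷ z ++ s))
      + downCount (ones (suc j) ++ ones (suc m)) z s
  downCount-ones j zero    z s = downCount-∷ (ones (suc j)) true z s
  downCount-ones j (suc m) z s = begin
    downCount (ones (suc j)) (true ∷ ones (suc m) ++ z) s
      ≡⟨ downCount-∷ (ones (suc j)) true (ones (suc m) ++ z) s ⟩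
    indicator (runConstrained (ones (suc j) ++ false ∷ (ones (suc m) ++ z) ++ s))
      + downCount (ones (suc j) ++ true ∷ []) (ones (suc m) ++ z) s
      ≡⟨ cong₂ _+_ (cong indicator (runConstrained-ones-zeros-false {j} {0} z≤n (cons ((ones m ++ z) ++ s))))
                   (cong (λ p → downCount p (ones (suc m) ++ z) s) (replicate-∷ʳ (suc j) true)) ⟩
    downCount (ones (suc (suc j))) (ones (suc m) ++ z) s
      ≡⟨ downCount-ones (suc j) m z s ⟩
    indicator (runConstrained (ones (suc (suc j)) ++ ones m ++ false ∷ z ++ s))
      + downCount (ones (suc (suc j)) ++ ones (suc m)) z s
      ≡⟨ sym (cong₂ (λ u v → indicator (runConstrained u) + downCount v z s)
                    (replicate-++-∷ (suc j) true (ones m ++ false ∷ z ++ s))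
                    (replicate-++-∷ (suc j) true (ones (suc m)))) ⟩
    indicator (runConstrained (ones (suc j) ++ ones (suc m) ++ false ∷ z ++ s))
      + downCount (ones (suc j) ++ ones (suc (suc m))) z s ∎

  -- Of the ones of a block 1^(a+1) 0^(a+2), exactly the first and the last can be cleared.
  blockDeg : ℕ → ℕ
  blockDeg zero    = 1
  blockDeg (suc _) = 2

  downCount-block : ∀ a w s → runConstrained (w ++ s) ≡ true →
    downCount [] (ones (suc a) ++ zeros (suc (suc a)) ++ w) s ≡ blockDeg a + downCount [] w s
  downCount-block zero w s ok = begin
    downCount [] (true ∷ zeros 2 ++ w) s
      ≡⟨ downCount-∷ [] true (zeros 2 ++ w) s ⟩
    indicator (runConstrained (zeros 3 ++ w ++ s)) + downCount (true ∷ []) (zeros 2 ++ w) s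
      ≡⟨ cong₂ _+_ (cong indicator (trans (runConstrained-zeros-++ 3 (w ++ s)) ok))
                   (downCount-zeros-++ (true ∷ []) 2 w s) ⟩
    1 + downCount (ones 1 ++ zeros 2) w s
      ≡⟨ cong (1 +_) (downCount-prefix (ones 1 ++ zeros 2) [] w s λ z → runConstrained-ones-zeros z (n<1+n 0)) ⟩
    1 + downCount [] w s ∎
  downCount-block (suc a) w s ok = begin
    downCount [] (true ∷ ones (suc a) ++ zeros (3 + a) ++ w) s
      ≡⟨ downCount-∷ [] true (ones (suc a) ++ zeros (3 + a) ++ w) s ⟩
    indicator (runConstrained (false ∷ (ones (suc a) ++ zeros (3 + a) ++ w) ++ s))
      + downCount (ones 1) (ones (suc a) ++ zeros (3 + a) ++ w) s
      ≡⟨ cong₂ _+_ (cong indicator clearFirst) (downCount-ones 0 a (zeros (3 + a) ++ w) s) ⟩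
    1 + (indicator (runConstrained (ones (suc a) ++ (zeros (4 + a) ++ w) ++ s))
      + downCount (ones (2 + a)) (zeros (3 + a) ++ w) s)
      ≡⟨ cong (λ b → 1 + (indicator b + downCount (ones (2 + a)) (zeros (3 + a) ++ w) s))
              (trans (runConstrained-ones-zeros-++ w s (m<n+m a z<s)) ok) ⟩
    2 + downCount (ones (2 + a)) (zeros (3 + a) ++ w) s
      ≡⟨ cong (2 +_) (downCount-zeros-++ (ones (2 + a)) (3 + a) w s) ⟩
    2 + downCount (ones (2 + a) ++ zeros (3 + a)) w s
      ≡⟨ cong (2 +_) (downCount-prefix (ones (2 + a) ++ zeros (3 + a)) [] w s λ z →
           trans (cong runConstrained (++-assoc (ones (2 + a)) (zeros (3 + a)) z))
                 (runConstrained-ones-zeros z (n<1+n (suc a)))) ⟩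
    2 + downCount [] w s ∎
    where
    clearFirst : runConstrained (false ∷ (ones (suc a) ++ zeros (3 + a) ++ w) ++ s) ≡ true
    clearFirst = begin
      runConstrained (false ∷ (ones (suc a) ++ zeros (3 + a) ++ w) ++ s)
        ≡⟨ runConstrained-0∷ ((ones (suc a) ++ zeros (3 + a) ++ w) ++ s) ⟩
      runConstrained ((ones (suc a) ++ zeros (3 + a) ++ w) ++ s)
        ≡⟨ cong runConstrained (++-assoc (ones (suc a)) (zeros (3 + a) ++ w) s) ⟩
      runConstrained (ones (suc a) ++ (zeros (3 + a) ++ w) ++ s)
        ≡⟨ runConstrained-ones-zeros-++ w s (m<n+m a z<s) ⟩
      runConstrained (w ++ s)
        ≡⟨ ok ⟩
      true ∎

-- Sums and convolutions

open import Data.Integer using (ℤ; _+_; _*_; _-_; -_; _^_; 0ℤ; 1ℤ)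
import Data.Integer.Properties as ℤ
open import Algebra.Properties.CommutativeSemigroup ℤ.+-commutativeSemigroup
  using () renaming (interchange to +-interchange)
open import Data.Integer.Tactic.RingSolver using (solve-∀; solve)

sumℤ-map-cong : ∀ {A : Set} {f g : A → ℤ} xs → (∀ x → f x ≡ g x) →
  sumℤ (map f xs) ≡ sumℤ (map g xs)
sumℤ-map-cong []       f≗g = refl
sumℤ-map-cong (x ∷ xs) f≗g = cong₂ _+_ (f≗g x) (sumℤ-map-cong xs f≗g)

sumℤ-map-zero : ∀ {A : Set} {f : A → ℤ} xs → (∀ x → f x ≡ 0ℤ) → sumℤ (map f xs) ≡ 0ℤ
sumℤ-map-zero []       f≗0 = refl
sumℤ-map-zero (x ∷ xs) f≗0 = cong₂ _+_ (f≗0 x) (sumℤ-map-zero xs f≗0)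

sumℤ-map-* : ∀ {A : Set} c (f : A → ℤ) xs → sumℤ (map (λ x → c * f x) xs) ≡ c * sumℤ (map f xs)
sumℤ-map-* c f []       = sym (ℤ.*-zeroʳ c)
sumℤ-map-* c f (x ∷ xs) = trans (cong (c * f x +_) (sumℤ-map-* c f xs)) (sym (ℤ.*-distribˡ-+ c (f x) _))

sumℤ-map-filterᵇ : ∀ {A : Set} (p : A → Bool) (f : A → ℤ) xs →
  sumℤ (map f (filterᵇ p xs)) ≡ sumℤ (map (λ x → if p x then f x else 0ℤ) xs)
sumℤ-map-filterᵇ p f []       = refl
sumℤ-map-filterᵇ p f (x ∷ xs) with p x
... | true  = cong (f x +_) (sumℤ-map-filterᵇ p f xs)
... | false = trans (sumℤ-map-filterᵇ p f xs) (sym (ℤ.+-identityˡ _))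

wordSum : ℕ → (List Bool → ℤ) → ℤ
wordSum n h = sumℤ (map h (words n))

wordSum-suc : ∀ n h → wordSum (suc n) h ≡ wordSum n (h ∘ (false ∷_)) + wordSum n (h ∘ (true ∷_))
wordSum-suc n h = go (words n)
  where
  go : ∀ ws → sumℤ (map h (concatMap (λ w → (false ∷ w) ∷ (true ∷ w) ∷ []) ws))
              ≡ sumℤ (map (h ∘ (false ∷_)) ws) + sumℤ (map (h ∘ (true ∷_)) ws)
  go []       = refl
  go (w ∷ ws) = begin
    h (false ∷ w) + (h (true ∷ w) + sumℤ (map h (concatMap _ ws)))
      ≡⟨ cong (λ x → h (false ∷ w) + (h (true ∷ w) + x)) (go ws) ⟩
    h (false ∷ w) + (h (true ∷ w) + (sumℤ (map (h ∘ (false ∷_)) ws) + sumℤ (map (h ∘ (true ∷_)) ws)))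
      ≡⟨ sym (ℤ.+-assoc (h (false ∷ w)) _ _) ⟩
    (h (false ∷ w) + h (true ∷ w)) + (sumℤ (map (h ∘ (false ∷_)) ws) + sumℤ (map (h ∘ (true ∷_)) ws))
      ≡⟨ +-interchange (h (false ∷ w)) _ _ _ ⟩
    (h (false ∷ w) + sumℤ (map (h ∘ (false ∷_)) ws)) + (h (true ∷ w) + sumℤ (map (h ∘ (true ∷_)) ws)) ∎

sumℤ-∷ʳ : ∀ xs x → sumℤ (xs ∷ʳ x) ≡ sumℤ xs + x
sumℤ-∷ʳ []       x = trans (ℤ.+-identityʳ x) (sym (ℤ.+-identityˡ x))
sumℤ-∷ʳ (y ∷ xs) x = trans (cong (y +_) (sumℤ-∷ʳ xs x)) (sym (ℤ.+-assoc y (sumℤ xs) x))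

sumℤ-applyUpTo-cong : ∀ {h h′ : ℕ → ℤ} n → (∀ {i} → i < n → h i ≡ h′ i) →
  sumℤ (applyUpTo h n) ≡ sumℤ (applyUpTo h′ n)
sumℤ-applyUpTo-cong zero    h≗h′ = refl
sumℤ-applyUpTo-cong (suc n) h≗h′ = cong₂ _+_ (h≗h′ (s≤s z≤n)) (sumℤ-applyUpTo-cong n (h≗h′ ∘ s≤s))

sumℤ-applyUpTo-reverse : ∀ (h : ℕ → ℤ) n →
  sumℤ (applyUpTo h n) ≡ sumℤ (applyUpTo (λ i → h (n ∸ suc i)) n)
sumℤ-applyUpTo-reverse h zero    = refl
sumℤ-applyUpTo-reverse h (suc n) = begin
  sumℤ (applyUpTo h (suc n))                                  ≡⟨ cong sumℤ (sym (applyUpTo-∷ʳ h n)) ⟩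
  sumℤ (applyUpTo h n ∷ʳ h n)                                 ≡⟨ sumℤ-∷ʳ (applyUpTo h n) (h n) ⟩
  sumℤ (applyUpTo h n) + h n                                  ≡⟨ cong (_+ h n) (sumℤ-applyUpTo-reverse h n) ⟩
  sumℤ (applyUpTo (λ i → h (n ∸ suc i)) n) + h n              ≡⟨ ℤ.+-comm _ (h n) ⟩
  h n + sumℤ (applyUpTo (λ i → h (n ∸ suc i)) n)              ∎

sumℤ-applyUpTo-vanishing : ∀ (h : ℕ → ℤ) m n → (∀ i → h (m ℕ.+ i) ≡ 0ℤ) →
  sumℤ (applyUpTo h (m ℕ.+ n)) ≡ sumℤ (applyUpTo h m)
sumℤ-applyUpTo-vanishing h zero    zero    h≗0 = refl
sumℤ-applyUpTo-vanishing h zero    (suc n) h≗0 =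
  trans (cong₂ _+_ (h≗0 0) (sumℤ-applyUpTo-vanishing (h ∘ suc) zero n (h≗0 ∘ suc))) (ℤ.+-identityˡ 0ℤ)
sumℤ-applyUpTo-vanishing h (suc m) n h≗0 = cong (h 0 +_) (sumℤ-applyUpTo-vanishing (h ∘ suc) m n h≗0)

⊛-comm : ∀ f g k → (f ⊛ g) k ≡ (g ⊛ f) k
⊛-comm f g k = begin
  (f ⊛ g) k
    ≡⟨ cong sumℤ (map-upTo (λ i → f i * g (k ∸ i)) (suc k)) ⟩
  sumℤ (applyUpTo (λ i → f i * g (k ∸ i)) (suc k))
    ≡⟨ sumℤ-applyUpTo-reverse (λ i → f i * g (k ∸ i)) (suc k) ⟩
  sumℤ (applyUpTo (λ i → f (k ∸ i) * g (k ∸ (k ∸ i))) (suc k))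
    ≡⟨ sumℤ-applyUpTo-cong (suc k) (λ {i} i<1+k → swap i i<1+k) ⟩
  sumℤ (applyUpTo (λ i → g i * f (k ∸ i)) (suc k))
    ≡⟨ cong sumℤ (sym (map-upTo (λ i → g i * f (k ∸ i)) (suc k))) ⟩
  (g ⊛ f) k ∎
  where
  swap : ∀ i → i < suc k → f (k ∸ i) * g (k ∸ (k ∸ i)) ≡ g i * f (k ∸ i)
  swap i (s≤s i≤k) =
    trans (cong (λ j → f (k ∸ i) * g j) (ℕ.m∸[m∸n]≡n i≤k)) (ℤ.*-comm (f (k ∸ i)) (g i))

denom-⊛ : ∀ d f j → (denom d ⊛ f) (5 ℕ.+ j) ≡
  f (5 ℕ.+ j) - f (4 ℕ.+ j) - f (3 ℕ.+ j) - (d - 1ℤ) * f (2 ℕ.+ j) - d * (d - 1ℤ) * f j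
denom-⊛ d f j = begin
  (denom d ⊛ f) (5 ℕ.+ j)
    ≡⟨ cong sumℤ (map-upTo h (6 ℕ.+ j)) ⟩
  sumℤ (applyUpTo h (6 ℕ.+ j))
    ≡⟨ sumℤ-applyUpTo-vanishing h 6 j (λ _ → refl) ⟩
  sumℤ (applyUpTo h 6)
    ≡⟨ expand d (f (5 ℕ.+ j)) (f (4 ℕ.+ j)) (f (3 ℕ.+ j)) (f (2 ℕ.+ j)) (f (1 ℕ.+ j)) (f j) ⟩
  f (5 ℕ.+ j) - f (4 ℕ.+ j) - f (3 ℕ.+ j) - (d - 1ℤ) * f (2 ℕ.+ j) - d * (d - 1ℤ) * f j ∎
  where
  h : ℕ → ℤ
  h i = denom d i * f (5 ℕ.+ j ∸ i)
  expand : ∀ d x₅ x₄ x₃ x₂ x₁ x₀ →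
    1ℤ * x₅ + (- 1ℤ * x₄ + (- 1ℤ * x₃ + (- (d - 1ℤ) * x₂ + (0ℤ * x₁ + (- (d * (d - 1ℤ)) * x₀ + 0ℤ)))))
    ≡ x₅ - x₄ - x₃ - (d - 1ℤ) * x₂ - d * (d - 1ℤ) * x₀
  expand = solve-∀

-- Enumerating vertices by their first block

shift : ℕ → Series → Series
shift zero    f m       = f m
shift (suc r) f zero    = 0ℤ
shift (suc r) f (suc m) = shift r f m

module _ (d : ℤ) where

  -- A vertex w contributes weight pad w to its enumerator; keeping the suffix general lets the
  -- padding zeros be moved into the word (weight-++-zeros).
  weight : List Bool → List Bool → ℤ
  weight s w = if runConstrained (w ++ s) then d ^ downCount [] w s else 0ℤ

  blockWeight : ℕ → ℤ
  blockWeight a = d ^ blockDeg a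

  weight-cong : ∀ s s′ w w′ → runConstrained (w ++ s) ≡ runConstrained (w′ ++ s′) →
    downCount [] w s ≡ downCount [] w′ s′ → weight s w ≡ weight s′ w′
  weight-cong s s′ w w′ rc dc rewrite rc | dc = refl

  weight-false : ∀ s w → runConstrained (w ++ s) ≡ false → weight s w ≡ 0ℤ
  weight-false s w rc rewrite rc = refl

  weight-0∷ : ∀ s w → weight s (false ∷ w) ≡ weight s w
  weight-0∷ s w = weight-cong s s (false ∷ w) w (runConstrained-0∷ (w ++ s))
    (downCount-prefix (false ∷ []) [] w s runConstrained-0∷)

  weight-block : ∀ a s w → weight s (ones (suc a) ++ zeros (2 ℕ.+ a) ++ w) ≡ blockWeight a * weight s w
  weight-block a s w rewrite runConstrained-block-++ a w s with runConstrained (w ++ s) in ok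
  ... | true  rewrite downCount-block a w s ok = ℤ.^-distribˡ-+-* d (blockDeg a) (downCount [] w s)
  ... | false = sym (ℤ.*-zeroʳ (blockWeight a))

  weight-ones-zeros-true∷ : ∀ {a b} s w → b ≤ a →
    weight s (ones (suc a) ++ zeros (suc b) ++ true ∷ w) ≡ 0ℤ
  weight-ones-zeros-true∷ {a} {b} s w b≤a =
    weight-false s (ones (suc a) ++ zeros (suc b) ++ true ∷ w) (runConstrained-ones-zeros-true∷-++ w s b≤a)

  weight-++-zeros : ∀ s w k → weight s (w ++ zeros k) ≡ weight (zeros k ++ s) w
  weight-++-zeros s w k = weight-cong s (zeros k ++ s) (w ++ zeros k) w
    (cong runConstrained (++-assoc w (zeros k) s)) (downCount-++-zeros [] w k s)

  downEnum≡wordSum : ∀ n → downEnum d n ≡ wordSum n (weight pad)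
  downEnum≡wordSum n = trans (sumℤ-map-filterᵇ isVertex (λ v → d ^ degDown v) (words n))
    (sumℤ-map-cong (words n) λ w → cong (λ k → if isVertex w then d ^ k else 0ℤ) (degDown≡downCount w))

  enumOnes : ℕ → ℕ → ℤ
  enumOnes a n = wordSum n (λ w → weight pad (ones (suc a) ++ w))

  enumOnesZeros : ℕ → ℕ → ℕ → ℤ
  enumOnesZeros a b n = wordSum n (λ w → weight pad (ones (suc a) ++ zeros (suc b) ++ w))

  downEnum-suc : ∀ n → downEnum d (suc n) ≡ downEnum d n + enumOnes 0 n
  downEnum-suc n = begin
    downEnum d (suc n)                                  ≡⟨ downEnum≡wordSum (suc n) ⟩
    wordSum (suc n) (weight pad)                        ≡⟨ wordSum-suc n (weight pad) ⟩
    wordSum n (weight pad ∘ (false ∷_)) + enumOnes 0 n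
      ≡⟨ cong (_+ enumOnes 0 n) (sumℤ-map-cong (words n) (weight-0∷ pad)) ⟩
    wordSum n (weight pad) + enumOnes 0 n               ≡⟨ cong (_+ enumOnes 0 n) (sym (downEnum≡wordSum n)) ⟩
    downEnum d n + enumOnes 0 n                         ∎

  enumOnes-suc : ∀ a n → enumOnes a (suc n) ≡ enumOnesZeros a 0 n + enumOnes (suc a) n
  enumOnes-suc a n = trans (wordSum-suc n _) (cong (enumOnesZeros a 0 n +_)
    (sumℤ-map-cong (words n) λ w → cong (weight pad) (replicate-++-∷ (suc a) true w)))

  enumOnesZeros-suc : ∀ a b n → b ≤ a → enumOnesZeros a b (suc n) ≡ enumOnesZeros a (suc b) n
  enumOnesZeros-suc a b n b≤a = begin
    enumOnesZeros a b (suc n)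
      ≡⟨ wordSum-suc n _ ⟩
    wordSum n (λ w → weight pad (ones (suc a) ++ zeros (suc b) ++ false ∷ w))
      + wordSum n (λ w → weight pad (ones (suc a) ++ zeros (suc b) ++ true ∷ w))
      ≡⟨ cong₂ _+_ (sumℤ-map-cong (words n) λ w →
                      cong (λ v → weight pad (ones (suc a) ++ v)) (replicate-++-∷ (suc b) false w))
                   (sumℤ-map-zero (words n) λ w → weight-ones-zeros-true∷ pad w b≤a) ⟩
    enumOnesZeros a (suc b) n + 0ℤ
      ≡⟨ ℤ.+-identityʳ _ ⟩
    enumOnesZeros a (suc b) n ∎

  enumOnesZeros-complete : ∀ a n → enumOnesZeros a (suc a) n ≡ blockWeight a * downEnum d n
  enumOnesZeros-complete a n = begin
    enumOnesZeros a (suc a) n                      ≡⟨ sumℤ-map-cong (words n) (weight-block a pad) ⟩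
    wordSum n (λ w → blockWeight a * weight pad w) ≡⟨ sumℤ-map-* (blockWeight a) (weight pad) (words n) ⟩
    blockWeight a * wordSum n (weight pad)         ≡⟨ cong (blockWeight a *_) (sym (downEnum≡wordSum n)) ⟩
    blockWeight a * downEnum d n                   ∎

  enumOnesZeros-0 : ∀ a b → enumOnesZeros a b 0 ≡ weight [] (ones (suc a) ++ zeros (3 ℕ.+ b) ++ [])
  enumOnesZeros-0 a b = begin
    weight pad u + 0ℤ              ≡⟨ ℤ.+-identityʳ (weight pad u) ⟩
    weight pad u                   ≡⟨ sym (weight-++-zeros [] u 2) ⟩
    weight [] (u ++ zeros 2)
      ≡⟨ cong (weight []) (++-assoc (ones (suc a)) (zeros (suc b) ++ []) (zeros 2)) ⟩
    weight [] (ones (suc a) ++ (zeros (suc b) ++ []) ++ zeros 2)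
      ≡⟨ cong (λ v → weight [] (ones (suc a) ++ v)) (++-assoc (zeros (suc b)) [] (zeros 2)) ⟩
    weight [] (ones (suc a) ++ zeros (suc b) ++ false ∷ false ∷ [])
      ≡⟨ cong (λ v → weight [] (ones (suc a) ++ v)) (replicate-++-∷ (suc b) false (false ∷ [])) ⟩
    weight [] (ones (suc a) ++ zeros (2 ℕ.+ b) ++ false ∷ [])
      ≡⟨ cong (λ v → weight [] (ones (suc a) ++ v)) (replicate-++-∷ (2 ℕ.+ b) false []) ⟩
    weight [] (ones (suc a) ++ zeros (3 ℕ.+ b) ++ []) ∎
    where
    u : List Bool
    u = ones (suc a) ++ zeros (suc b) ++ []

  enumOnes-0 : ∀ a → enumOnes (suc a) 0 ≡ 0ℤ
  enumOnes-0 a = begin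
    weight pad u + 0ℤ ≡⟨ ℤ.+-identityʳ (weight pad u) ⟩
    weight pad u      ≡⟨ weight-false pad u (trans (cong runConstrained (++-assoc (ones (2 ℕ.+ a)) [] pad))
                                                   (runConstrained-ones-zeros-false {suc a} {1} (s≤s z≤n) nil)) ⟩
    0ℤ                ∎
    where
    u : List Bool
    u = ones (2 ℕ.+ a) ++ []

  -- downEnum₋₂ m stands for downEnum (m - 2), with the value 1 at m = 0, 1: a final block can
  -- take one or two of its zeros from the padding.
  downEnum₋₂ : Series
  downEnum₋₂ 0             = 1ℤ
  downEnum₋₂ 1             = 1ℤ
  downEnum₋₂ (suc (suc n)) = downEnum d n

  -- The prefix 1^(r+b+1) 0^(b+1) still needs r + 1 zeros to complete its block.
  enumOnesZeros-closed : ∀ n r b →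
    enumOnesZeros (r ℕ.+ b) b n ≡ blockWeight (r ℕ.+ b) * shift (suc r) downEnum₋₂ (2 ℕ.+ n)
  enumOnesZeros-closed zero    zero          b = begin
    enumOnesZeros b b 0
      ≡⟨ enumOnesZeros-0 b b ⟩
    weight [] (ones (suc b) ++ zeros (3 ℕ.+ b) ++ [])
      ≡⟨ cong (λ v → weight [] (ones (suc b) ++ v)) (sym (replicate-++-∷ (2 ℕ.+ b) false [])) ⟩
    weight [] (ones (suc b) ++ zeros (2 ℕ.+ b) ++ false ∷ [])
      ≡⟨ weight-block b [] (false ∷ []) ⟩
    blockWeight b * 1ℤ ∎
  enumOnesZeros-closed zero    (suc zero)    b = trans (enumOnesZeros-0 (suc b) b) (weight-block (suc b) [] [])
  enumOnesZeros-closed zero    (suc (suc r)) b = begin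
    enumOnesZeros a b 0 ≡⟨ enumOnesZeros-0 a b ⟩
    weight [] v         ≡⟨ weight-false [] v (trans (cong runConstrained (++-identityʳ v))
                                                   (runConstrained-ones-zeros-false (s≤s (s≤s (ℕ.m≤n+m b r))) nil)) ⟩
    0ℤ                  ≡⟨ sym (ℤ.*-zeroʳ (blockWeight a)) ⟩
    blockWeight a * 0ℤ  ∎
    where
    a : ℕ
    a = 2 ℕ.+ r ℕ.+ b
    v : List Bool
    v = ones (suc a) ++ zeros (3 ℕ.+ b) ++ []
  enumOnesZeros-closed (suc n) zero          b =
    trans (enumOnesZeros-suc b b n ℕ.≤-refl) (enumOnesZeros-complete b n)
  enumOnesZeros-closed (suc n) (suc r)       b = begin
    enumOnesZeros (suc (r ℕ.+ b)) b (suc n)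
      ≡⟨ enumOnesZeros-suc (suc (r ℕ.+ b)) b n (ℕ.m≤n+m b (suc r)) ⟩
    enumOnesZeros (suc (r ℕ.+ b)) (suc b) n
      ≡⟨ cong (λ a → enumOnesZeros a (suc b) n) (sym (ℕ.+-suc r b)) ⟩
    enumOnesZeros (r ℕ.+ suc b) (suc b) n
      ≡⟨ enumOnesZeros-closed n r (suc b) ⟩
    blockWeight (r ℕ.+ suc b) * shift (suc r) downEnum₋₂ (2 ℕ.+ n)
      ≡⟨ cong (λ a → blockWeight a * shift (suc r) downEnum₋₂ (2 ℕ.+ n)) (ℕ.+-suc r b) ⟩
    blockWeight (suc (r ℕ.+ b)) * shift (suc r) downEnum₋₂ (2 ℕ.+ n) ∎

  enumOnes-suc-closed : ∀ a n →
    enumOnes a (suc n) ≡ blockWeight a * shift a downEnum₋₂ (suc n) + enumOnes (suc a) n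
  enumOnes-suc-closed a n = begin
    enumOnes a (suc n)
      ≡⟨ enumOnes-suc a n ⟩
    enumOnesZeros a 0 n + enumOnes (suc a) n
      ≡⟨ cong (λ c → enumOnesZeros c 0 n + enumOnes (suc a) n) (sym (ℕ.+-identityʳ a)) ⟩
    enumOnesZeros (a ℕ.+ 0) 0 n + enumOnes (suc a) n
      ≡⟨ cong (_+ enumOnes (suc a) n) (enumOnesZeros-closed n a 0) ⟩
    blockWeight (a ℕ.+ 0) * shift a downEnum₋₂ (suc n) + enumOnes (suc a) n
      ≡⟨ cong (λ c → blockWeight c * shift a downEnum₋₂ (suc n) + enumOnes (suc a) n) (ℕ.+-identityʳ a) ⟩
    blockWeight a * shift a downEnum₋₂ (suc n) + enumOnes (suc a) n ∎

  enumOnes-2+ : ∀ a n → enumOnes (2 ℕ.+ a) (suc n) ≡ enumOnes (suc a) n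
  enumOnes-2+ a zero = begin
    enumOnes (2 ℕ.+ a) 1
      ≡⟨ enumOnes-suc-closed (2 ℕ.+ a) 0 ⟩
    blockWeight (2 ℕ.+ a) * 0ℤ + enumOnes (3 ℕ.+ a) 0
      ≡⟨ cong₂ _+_ (ℤ.*-zeroʳ (blockWeight (2 ℕ.+ a))) (enumOnes-0 (2 ℕ.+ a)) ⟩
    0ℤ
      ≡⟨ sym (enumOnes-0 a) ⟩
    enumOnes (suc a) 0 ∎
  enumOnes-2+ a (suc n) = begin
    enumOnes (2 ℕ.+ a) (2 ℕ.+ n)
      ≡⟨ enumOnes-suc-closed (2 ℕ.+ a) (suc n) ⟩
    blockWeight (2 ℕ.+ a) * shift (2 ℕ.+ a) downEnum₋₂ (2 ℕ.+ n) + enumOnes (3 ℕ.+ a) (suc n)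
      ≡⟨ cong (blockWeight (2 ℕ.+ a) * shift (2 ℕ.+ a) downEnum₋₂ (2 ℕ.+ n) +_) (enumOnes-2+ (suc a) n) ⟩
    blockWeight (suc a) * shift (suc a) downEnum₋₂ (suc n) + enumOnes (2 ℕ.+ a) n
      ≡⟨ sym (enumOnes-suc-closed (suc a) n) ⟩
    enumOnes (suc a) (suc n) ∎

  enumOnes-0-2 : ∀ n → enumOnes 0 n ≡ blockWeight 0 * downEnum₋₂ n + enumOnes 2 n
  enumOnes-0-2 zero = begin
    blockWeight 0 + 0ℤ        ≡⟨ cong (_+ 0ℤ) (sym (ℤ.*-identityʳ (blockWeight 0))) ⟩
    blockWeight 0 * 1ℤ + 0ℤ   ≡⟨ cong (blockWeight 0 * 1ℤ +_) (sym (enumOnes-0 1)) ⟩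
    blockWeight 0 * 1ℤ + enumOnes 2 0 ∎
  enumOnes-0-2 (suc n) = trans (enumOnes-suc-closed 0 n)
    (cong (blockWeight 0 * downEnum₋₂ (suc n) +_) (sym (enumOnes-2+ 0 n)))

  downEnum-recurrence : ∀ n → downEnum d (3 ℕ.+ n) ≡
    downEnum d (2 ℕ.+ n) + downEnum d (1 ℕ.+ n) + (d - 1ℤ) * downEnum d n + d * (d - 1ℤ) * downEnum₋₂ n
  downEnum-recurrence n = begin
    downEnum d (3 ℕ.+ n)
      ≡⟨ downEnum-suc (2 ℕ.+ n) ⟩
    downEnum d (2 ℕ.+ n) + enumOnes 0 (2 ℕ.+ n)
      ≡⟨ cong (downEnum d (2 ℕ.+ n) +_) (enumOnes-suc-closed 0 (suc n)) ⟩
    downEnum d (2 ℕ.+ n) + (d ^ 1 * downEnum d n + enumOnes 1 (suc n))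
      ≡⟨ cong (λ x → downEnum d (2 ℕ.+ n) + (d ^ 1 * downEnum d n + x)) (enumOnes-suc-closed 1 n) ⟩
    downEnum d (2 ℕ.+ n) + (d ^ 1 * downEnum d n + (d ^ 2 * downEnum₋₂ n + enumOnes 2 n))
      ≡⟨ regroup d (downEnum d (2 ℕ.+ n)) (downEnum d n) (downEnum₋₂ n) (enumOnes 2 n) ⟩
    downEnum d (2 ℕ.+ n) + (downEnum d n + (d ^ 1 * downEnum₋₂ n + enumOnes 2 n))
      + (d - 1ℤ) * downEnum d n + d * (d - 1ℤ) * downEnum₋₂ n
      ≡⟨ cong (λ x → downEnum d (2 ℕ.+ n) + (downEnum d n + x)
                       + (d - 1ℤ) * downEnum d n + d * (d - 1ℤ) * downEnum₋₂ n)
              (sym (enumOnes-0-2 n)) ⟩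
    downEnum d (2 ℕ.+ n) + (downEnum d n + enumOnes 0 n) + (d - 1ℤ) * downEnum d n + d * (d - 1ℤ) * downEnum₋₂ n
      ≡⟨ cong (λ x → downEnum d (2 ℕ.+ n) + x + (d - 1ℤ) * downEnum d n + d * (d - 1ℤ) * downEnum₋₂ n)
              (sym (downEnum-suc n)) ⟩
    downEnum d (2 ℕ.+ n) + downEnum d (1 ℕ.+ n) + (d - 1ℤ) * downEnum d n + d * (d - 1ℤ) * downEnum₋₂ n ∎
    where
    regroup : ∀ c g₂ g₀ e o → g₂ + (c * 1ℤ * g₀ + (c * (c * 1ℤ) * e + o))
                            ≡ g₂ + (g₀ + (c * 1ℤ * e + o)) + (c - 1ℤ) * g₀ + c * (c - 1ℤ) * e
    regroup = solve-∀

  downEnum-1 : downEnum d 1 ≡ 1ℤ + d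
  downEnum-1 = begin
    downEnum d 1             ≡⟨⟩
    1ℤ + (d * 1ℤ + 0ℤ)       ≡⟨ solve (d ∷ []) ⟩
    1ℤ + d                   ∎

  downEnum-2 : downEnum d 2 ≡ 1ℤ + d + d
  downEnum-2 = begin
    downEnum d 2                     ≡⟨⟩
    1ℤ + (d * 1ℤ + (d * 1ℤ + 0ℤ))    ≡⟨ solve (d ∷ []) ⟩
    1ℤ + d + d                       ∎

  coefficient-5+ : ∀ j → (genFun d ⊛ denom d) (5 ℕ.+ j) ≡ d * (d - 1ℤ) * (downEnum d j - genFun d j)
  coefficient-5+ j = begin
    (genFun d ⊛ denom d) (5 ℕ.+ j)
      ≡⟨ ⊛-comm (genFun d) (denom d) (5 ℕ.+ j) ⟩
    (denom d ⊛ genFun d) (5 ℕ.+ j)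
      ≡⟨ denom-⊛ d (genFun d) j ⟩
    G (5 ℕ.+ j) - G (4 ℕ.+ j) - G (3 ℕ.+ j) - (d - 1ℤ) * G (2 ℕ.+ j) - d * (d - 1ℤ) * genFun d j
      ≡⟨ cong (λ x → x - G (4 ℕ.+ j) - G (3 ℕ.+ j) - (d - 1ℤ) * G (2 ℕ.+ j) - d * (d - 1ℤ) * genFun d j)
              (downEnum-recurrence (2 ℕ.+ j)) ⟩
    G (4 ℕ.+ j) + G (3 ℕ.+ j) + (d - 1ℤ) * G (2 ℕ.+ j) + d * (d - 1ℤ) * G j
      - G (4 ℕ.+ j) - G (3 ℕ.+ j) - (d - 1ℤ) * G (2 ℕ.+ j) - d * (d - 1ℤ) * genFun d j
      ≡⟨ cancel d (G (4 ℕ.+ j)) (G (3 ℕ.+ j)) (G (2 ℕ.+ j)) (G j) (genFun d j) ⟩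
    d * (d - 1ℤ) * (G j - genFun d j) ∎
    where
    G : ℕ → ℤ
    G = downEnum d
    cancel : ∀ c x₄ x₃ x₂ x₀ y → x₄ + x₃ + (c - 1ℤ) * x₂ + c * (c - 1ℤ) * x₀
                                 - x₄ - x₃ - (c - 1ℤ) * x₂ - c * (c - 1ℤ) * y ≡ c * (c - 1ℤ) * (x₀ - y)
    cancel = solve-∀

-- The left-hand sides below are the sums (genFun d ⊛ denom d) k, k = 1, …, 4, as they unfold.

coefficient₁ : ∀ d x₁ → x₁ ≡ 1ℤ + d → 0ℤ * - 1ℤ + (x₁ * 1ℤ + 0ℤ) ≡ 1ℤ + d
coefficient₁ d _ refl = solve (d ∷ [])

coefficient₂ : ∀ d x₁ x₂ → x₁ ≡ 1ℤ + d → x₂ ≡ 1ℤ + d + d →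
  0ℤ * - 1ℤ + (x₁ * - 1ℤ + (x₂ * 1ℤ + 0ℤ)) ≡ d
coefficient₂ d _ _ refl refl = solve (d ∷ [])

coefficient₃ : ∀ d x₁ x₂ x₃ → x₃ ≡ x₂ + x₁ + (d - 1ℤ) * 1ℤ + d * (d - 1ℤ) * 1ℤ →
  0ℤ * - (d - 1ℤ) + (x₁ * - 1ℤ + (x₂ * - 1ℤ + (x₃ * 1ℤ + 0ℤ))) ≡ d * d - 1ℤ
coefficient₃ d x₁ x₂ _ refl = solve (d ∷ x₁ ∷ x₂ ∷ [])

coefficient₄ : ∀ d x₁ x₂ x₃ x₄ → x₄ ≡ x₃ + x₂ + (d - 1ℤ) * x₁ + d * (d - 1ℤ) * 1ℤ →
  0ℤ * 0ℤ + (x₁ * - (d - 1ℤ) + (x₂ * - 1ℤ + (x₃ * - 1ℤ + (x₄ * 1ℤ + 0ℤ)))) ≡ d * (d - 1ℤ)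
coefficient₄ d x₁ x₂ x₃ _ refl = solve (d ∷ x₁ ∷ x₂ ∷ x₃ ∷ [])

proposition7p1 : (d : ℤ) → (k : ℕ) → (genFun d ⊛ denom d) k ≡ numer d k
proposition7p1 d 0 = refl
proposition7p1 d 1 = coefficient₁ d (downEnum d 1) (downEnum-1 d)
proposition7p1 d 2 = coefficient₂ d (downEnum d 1) (downEnum d 2) (downEnum-1 d) (downEnum-2 d)
proposition7p1 d 3 = coefficient₃ d (downEnum d 1) (downEnum d 2) (downEnum d 3) (downEnum-recurrence d 0)
proposition7p1 d 4 =
  coefficient₄ d (downEnum d 1) (downEnum d 2) (downEnum d 3) (downEnum d 4) (downEnum-recurrence d 1)
proposition7p1 d 5 = trans (coefficient-5+ d 0) (ℤ.*-identityʳ (d * (d - 1ℤ)))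
proposition7p1 d (suc (suc (suc (suc (suc (suc j)))))) = begin
  (genFun d ⊛ denom d) (6 ℕ.+ j)                            ≡⟨ coefficient-5+ d (suc j) ⟩
  d * (d - 1ℤ) * (downEnum d (suc j) - downEnum d (suc j))
    ≡⟨ cong (d * (d - 1ℤ) *_) (ℤ.+-inverseʳ (downEnum d (suc j))) ⟩
  d * (d - 1ℤ) * 0ℤ                                         ≡⟨ ℤ.*-zeroʳ (d * (d - 1ℤ)) ⟩
  0ℤ                                                        ∎
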